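{- For every positive integer $n$, \[ \sum_{m=1}^{2^{n}} g(m)=\frac{4^{n}+6^{n}}{2}. \]
   Context: For a positive integer $m$, the chocolate game $C_{m,m}$ is a two-player impartial game on an $m\times m$ chocolate bar of unit cells, exactly one of which is poisoned (known to both players); cells are $(i,j)$ with $1\le i,j\le m$. Players alternately break the current bar along a grid line into two rectangular pieces, eat one and pass the other (always keeping the poisoned cell); a player who receives the $1\times1$ bar loses. A cell is a P-position if with poison there the second player has a winning strategy; $P_{m,m}$ is the set of P-positions. It is known that $(i,j)\in P_{m,m}$ iff $(i-1)\oplus(j-1)\oplus(m-i)\oplus(m-j)=0$ ($\oplus$ = bitwise XOR). Define $g(m)=\#P_{m,m}$. -}

module Defs where

open import Data.Nat using (ℕ; zero; suc; _+_; _*_; _∸_; _≟_)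
open import Data.Nat.DivMod using (_/_; _%_)
open import Data.Bool using (Bool; true; false; if_then_else_)
open import Data.List using (List; length; filter; map; concatMap)
open import Data.Nat.ListAction using (sum)
open import Data.List using (upTo)
open import Data.Product using (_×_; _,_)
open import Relation.Nullary.Decidable using (⌊_⌋)

-- bitwise XOR of natural numbers, computed with fuel (the fuel a + b
-- is always enough since each step halves both arguments)
xorFuel : ℕ → ℕ → ℕ → ℕ
xorFuel zero    a b = 0
xorFuel (suc k) a b =
  (if ⌊ (a % 2) ≟ (b % 2) ⌋ then 0 else 1) + 2 * xorFuel k (a / 2) (b / 2)

infixl 6 _⊕_
_⊕_ : ℕ → ℕ → ℕ
a ⊕ b = xorFuel (a + b) a b

range1 : ℕ → List ℕ
range1 m = map suc (upTo m)

cells : ℕ → List (ℕ × ℕ)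
cells m = concatMap (λ i → map (λ j → (i , j)) (range1 m)) (range1 m)

-- P-position criterion for C_{m,m} (as given in the paper's context)
isP : ℕ → ℕ × ℕ → Bool
isP m (i , j) = ⌊ ((i ∸ 1) ⊕ (j ∸ 1) ⊕ (m ∸ i) ⊕ (m ∸ j)) ≟ 0 ⌋

g : ℕ → ℕ
g m = length (filter (λ c → isP m c Data.Bool.≟ true) (cells m))

sumG : ℕ → ℕ
sumG N = sum (map g (range1 N))

-- Let G(k) = g(k + 1), write a cell as (1 + a , 1 + b), and compare the binary digits of
-- a, b, k − a, k − b.  For odd k = 2s + 1 the last digits of every cell cancel and the
-- cell reduces to (a/2 , b/2) for k = s, so G(2s + 1) = 4 G(s).  For even k = 2s + 2 the
-- cells with both coordinates even (odd) reduce to k = s + 1 (k = s), while in a mixed cell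
-- the four halved numbers have odd sum, so it is never a P-position; thus
-- G(2s + 2) = G(s + 1) + G(s).  With S(N) = Σ_{k<N} G(k) this gives
-- S(2M) = 6 S(M) − G(M − 1), and G(2^n − 1) = 4^n, so 2 S(2^n) = 4^n + 6^n by induction.

module Submission where

open import Defs
open import Data.Nat
  using (ℕ; zero; suc; _+_; _*_; _^_; _∸_; _≤_; _<_; z≤n; s≤s; s≤s⁻¹; _≟_; NonZero)
open import Data.Nat.Properties
open import Data.Nat.DivMod
open import Data.Nat.ListAction using (sum)
open import Data.Nat.ListAction.Properties using (sum-++)
open import Data.Nat.Tactic.RingSolver using (solve-∀)
open import Data.Bool using (Bool; true; false; not; _xor_; if_then_else_)
import Data.Bool as Bool
open import Data.List using (List; []; _∷_; _++_; map; filter; length; concatMap; applyUpTo)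
open import Data.List.Properties using (map-∘; map-++)
open import Data.Product using (_×_; _,_)
open import Function using (_∘_; id)
open import Relation.Nullary.Decidable using (⌊_⌋)
open import Relation.Binary.PropositionalEquality
  using (_≡_; refl; sym; trans; cong; cong₂; subst; module ≡-Reasoning)
open import Algebra.Properties.CommutativeSemigroup +-commutativeSemigroup
  using (interchange; xy∙z≈xz∙y)

∑< : ℕ → (ℕ → ℕ) → ℕ
∑< zero    f = 0
∑< (suc n) f = f 0 + ∑< n (f ∘ suc)

syntax ∑< n (λ i → e) = ∑[ i < n ] e

∑-cong : ∀ n {f g : ℕ → ℕ} → (∀ i → i < n → f i ≡ g i) → ∑< n f ≡ ∑< n g
∑-cong zero    f≡g = refl
∑-cong (suc n) f≡g =
  cong₂ _+_ (f≡g 0 (s≤s z≤n)) (∑-cong n (λ i i<n → f≡g (suc i) (s≤s i<n)))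

∑-+ : ∀ n (f g : ℕ → ℕ) → ∑[ i < n ] (f i + g i) ≡ ∑< n f + ∑< n g
∑-+ zero    f g = refl
∑-+ (suc n) f g = trans (cong (f 0 + g 0 +_) (∑-+ n (f ∘ suc) (g ∘ suc)))
                        (interchange (f 0) (g 0) _ _)

∑-* : ∀ n k (f : ℕ → ℕ) → ∑[ i < n ] (k * f i) ≡ k * ∑< n f
∑-* zero    k f = sym (*-zeroʳ k)
∑-* (suc n) k f = trans (cong (k * f 0 +_) (∑-* n k (f ∘ suc)))
                        (sym (*-distribˡ-+ k (f 0) _))

∑-zero : ∀ n → ∑[ i < n ] 0 ≡ 0
∑-zero zero    = refl
∑-zero (suc n) = ∑-zero n

∑-snoc : ∀ n (f : ℕ → ℕ) → ∑< (suc n) f ≡ ∑< n f + f n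
∑-snoc zero    f = +-comm (f 0) 0
∑-snoc (suc n) f = trans (cong (f 0 +_) (∑-snoc n (f ∘ suc))) (sym (+-assoc (f 0) _ _))

∑-2* : ∀ n (f : ℕ → ℕ) → ∑< (2 * n) f ≡ ∑[ i < n ] f (2 * i) + ∑[ i < n ] f (1 + 2 * i)
∑-2* zero    f = refl
∑-2* (suc n) f = begin
  ∑< (2 * suc n) f
    ≡⟨ cong (λ m → ∑< m f) (*-suc 2 n) ⟩
  f 0 + (f 1 + ∑< (2 * n) (f ∘ suc ∘ suc))
    ≡⟨ sym (+-assoc (f 0) (f 1) _) ⟩
  f 0 + f 1 + ∑< (2 * n) (f ∘ suc ∘ suc)
    ≡⟨ cong (f 0 + f 1 +_) (∑-2* n (f ∘ suc ∘ suc)) ⟩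
  f 0 + f 1 + (∑[ i < n ] f (2 + 2 * i) + ∑[ i < n ] f (3 + 2 * i))
    ≡⟨ interchange (f 0) (f 1) _ _ ⟩
  f 0 + ∑[ i < n ] f (2 + 2 * i) + (f 1 + ∑[ i < n ] f (3 + 2 * i))
    ≡⟨ sym (cong₂ (λ s t → f 0 + s + (f 1 + t)) (evens f) (evens (f ∘ suc))) ⟩
  ∑[ i < suc n ] f (2 * i) + ∑[ i < suc n ] f (1 + 2 * i) ∎
  where
  open ≡-Reasoning
  evens : ∀ (h : ℕ → ℕ) → ∑[ i < n ] h (2 * suc i) ≡ ∑[ i < n ] h (2 + 2 * i)
  evens h = ∑-cong n (λ i _ → cong h (*-suc 2 i))

∑-1+2* : ∀ n (f : ℕ → ℕ) →
         ∑< (1 + 2 * n) f ≡ ∑[ i < suc n ] f (2 * i) + ∑[ i < n ] f (1 + 2 * i)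
∑-1+2* n f = begin
  f 0 + ∑< (2 * n) (f ∘ suc)
    ≡⟨ cong (f 0 +_) (∑-2* n (f ∘ suc)) ⟩
  f 0 + (∑[ i < n ] f (1 + 2 * i) + ∑[ i < n ] f (2 + 2 * i))
    ≡⟨ cong (f 0 +_) (+-comm (∑[ i < n ] f (1 + 2 * i)) _) ⟩
  f 0 + (∑[ i < n ] f (2 + 2 * i) + ∑[ i < n ] f (1 + 2 * i))
    ≡⟨ sym (+-assoc (f 0) _ _) ⟩
  f 0 + ∑[ i < n ] f (2 + 2 * i) + ∑[ i < n ] f (1 + 2 * i)
    ≡⟨ cong (λ s → f 0 + s + ∑[ i < n ] f (1 + 2 * i)) (∑-cong n (λ i _ → cong f (sym (*-suc 2 i)))) ⟩
  ∑[ i < suc n ] f (2 * i) + ∑[ i < n ] f (1 + 2 * i) ∎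
  where open ≡-Reasoning

∑-2*-same : ∀ n (f g : ℕ → ℕ) →
            (∀ i → i < n → f (2 * i) ≡ g i) → (∀ i → i < n → f (1 + 2 * i) ≡ g i) →
            ∑< (2 * n) f ≡ 2 * ∑< n g
∑-2*-same n f g evens odds = begin
  ∑< (2 * n) f                                        ≡⟨ ∑-2* n f ⟩
  ∑[ i < n ] f (2 * i) + ∑[ i < n ] f (1 + 2 * i)     ≡⟨ cong₂ _+_ (∑-cong n evens) (∑-cong n odds) ⟩
  ∑< n g + ∑< n g                                     ≡⟨ cong (∑< n g +_) (+-identityʳ (∑< n g)) ⟨
  2 * ∑< n g                                          ∎
  where open ≡-Reasoning

bit : Bool → ℕ
bit false = 0
bit true  = 1

module _ {A : Set} where

  length-filter≡sum-bit : ∀ (P : A → Bool) xs →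
    length (filter (λ x → P x Bool.≟ true) xs) ≡ sum (map (bit ∘ P) xs)
  length-filter≡sum-bit P []       = refl
  length-filter≡sum-bit P (x ∷ xs) with P x
  ... | true  = cong suc (length-filter≡sum-bit P xs)
  ... | false = length-filter≡sum-bit P xs

  sum-map-applyUpTo : ∀ (f : A → ℕ) (h : ℕ → A) n → sum (map f (applyUpTo h n)) ≡ ∑[ i < n ] f (h i)
  sum-map-applyUpTo f h zero    = refl
  sum-map-applyUpTo f h (suc n) = cong (f (h 0) +_) (sum-map-applyUpTo f (h ∘ suc) n)

  sum-map-concatMap : ∀ {B : Set} (f : B → ℕ) (h : A → List B) xs →
    sum (map f (concatMap h xs)) ≡ sum (map (λ x → sum (map f (h x))) xs)
  sum-map-concatMap f h []       = refl
  sum-map-concatMap f h (x ∷ xs) = begin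
    sum (map f (h x ++ concatMap h xs))                 ≡⟨ cong sum (map-++ f (h x) (concatMap h xs)) ⟩
    sum (map f (h x) ++ map f (concatMap h xs))         ≡⟨ sum-++ (map f (h x)) (map f (concatMap h xs)) ⟩
    sum (map f (h x)) + sum (map f (concatMap h xs))    ≡⟨ cong (sum (map f (h x)) +_) (sum-map-concatMap f h xs) ⟩
    sum (map f (h x)) + sum (map (λ y → sum (map f (h y))) xs) ∎
    where open ≡-Reasoning

sum-map-range1 : ∀ (f : ℕ → ℕ) n → sum (map f (range1 n)) ≡ ∑[ i < n ] f (suc i)
sum-map-range1 f n = trans (cong sum (sym (map-∘ (applyUpTo id n))))
                           (sum-map-applyUpTo (f ∘ suc) id n)

%-+-congˡ : ∀ m n o {d} .{{_ : NonZero d}} → m % d ≡ n % d → (m + o) % d ≡ (n + o) % d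
%-+-congˡ m n o {d} m≡n = begin
  (m + o) % d           ≡⟨ %-distribˡ-+ m o d ⟩
  (m % d + o % d) % d   ≡⟨ cong (λ r → (r + o % d) % d) m≡n ⟩
  (n % d + o % d) % d   ≡⟨ %-distribˡ-+ n o d ⟨
  (n + o) % d           ∎
  where open ≡-Reasoning

[m+2n]%2≡m%2 : ∀ m n → (m + 2 * n) % 2 ≡ m % 2
[m+2n]%2≡m%2 m n = trans (cong (λ k → (m + k) % 2) (*-comm 2 n)) ([m+kn]%n≡m%n m n 2)

[bit+2n]%2≡bit : ∀ p n → (bit p + 2 * n) % 2 ≡ bit p
[bit+2n]%2≡bit false n = [m+2n]%2≡m%2 0 n
[bit+2n]%2≡bit true  n = [m+2n]%2≡m%2 1 n

[bit+2n]/2≡n : ∀ p n → (bit p + 2 * n) / 2 ≡ n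
[bit+2n]/2≡n false n = trans (cong (_/ 2) (*-comm 2 n)) (m*n/n≡m n 2)
[bit+2n]/2≡n true  n = begin
  (1 + 2 * n) / 2   ≡⟨ cong (λ k → (1 + k) / 2) (*-comm 2 n) ⟩
  (1 + n * 2) / 2   ≡⟨ +-distrib-/ 1 (n * 2) (subst (λ r → 1 + r < 2) (sym (m*n%n≡0 n 2)) ≤-refl) ⟩
  n * 2 / 2         ≡⟨ m*n/n≡m n 2 ⟩
  n                 ∎
  where open ≡-Reasoning

xorFuel-0-0 : ∀ f → xorFuel f 0 0 ≡ 0
xorFuel-0-0 zero    = refl
xorFuel-0-0 (suc f) = cong (2 *_) (xorFuel-0-0 f)

*2≤1+⇒≤ : ∀ {m n} → m * 2 ≤ suc n → m ≤ n
*2≤1+⇒≤ {zero}  _         = z≤n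
*2≤1+⇒≤ {suc m} (s≤s m≤n) = ≤-trans (s≤s (m≤m*n m 2)) m≤n

halves-≤ : ∀ a b {f} → a + b ≤ suc f → a / 2 + b / 2 ≤ f
halves-≤ a b a+b≤1+f = *2≤1+⇒≤ (begin
  (a / 2 + b / 2) * 2     ≡⟨ *-distribʳ-+ 2 (a / 2) (b / 2) ⟩
  a / 2 * 2 + b / 2 * 2   ≤⟨ +-mono-≤ (m/n*n≤m a 2) (m/n*n≤m b 2) ⟩
  a + b                   ≤⟨ a+b≤1+f ⟩
  suc _                   ∎)
  where open ≤-Reasoning

digitXor : ℕ → ℕ → ℕ
digitXor u v = if ⌊ u ≟ v ⌋ then 0 else 1

lowXor : ℕ → ℕ → ℕ
lowXor a b = digitXor (a % 2) (b % 2)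

xorFuel-stable : ∀ {f f′} a b → a + b ≤ f → a + b ≤ f′ → xorFuel f a b ≡ xorFuel f′ a b
xorFuel-stable {zero}  {f′}     zero zero _ _ = sym (xorFuel-0-0 f′)
xorFuel-stable {suc f} {zero}   zero zero _ _ = xorFuel-0-0 (suc f)
xorFuel-stable {suc f} {suc f′} a    b    p q =
  cong (λ x → lowXor a b + 2 * x) (xorFuel-stable (a / 2) (b / 2) (halves-≤ a b p) (halves-≤ a b q))

⊕-step : ∀ a b → a ⊕ b ≡ lowXor a b + 2 * (a / 2 ⊕ b / 2)
⊕-step a b = begin
  xorFuel (a + b) a b
    ≡⟨ xorFuel-stable a b ≤-refl (n≤1+n (a + b)) ⟩
  xorFuel (suc (a + b)) a b
    ≡⟨ cong (λ x → lowXor a b + 2 * x) (xorFuel-stable (a / 2) (b / 2) fuel≤ ≤-refl) ⟩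
  lowXor a b + 2 * (a / 2 ⊕ b / 2) ∎
  where
  open ≡-Reasoning
  fuel≤ : a / 2 + b / 2 ≤ a + b
  fuel≤ = halves-≤ a b (n≤1+n (a + b))

digitXor-bit : ∀ p q → digitXor (bit p) (bit q) ≡ bit (p xor q)
digitXor-bit false false = refl
digitXor-bit false true  = refl
digitXor-bit true  false = refl
digitXor-bit true  true  = refl

digitXor≡[u+v]%2 : ∀ {u v} → u < 2 → v < 2 → digitXor u v ≡ (u + v) % 2
digitXor≡[u+v]%2 (s≤s z≤n)       (s≤s z≤n)       = refl
digitXor≡[u+v]%2 (s≤s z≤n)       (s≤s (s≤s z≤n)) = refl
digitXor≡[u+v]%2 (s≤s (s≤s z≤n)) (s≤s z≤n)       = refl
digitXor≡[u+v]%2 (s≤s (s≤s z≤n)) (s≤s (s≤s z≤n)) = refl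

⊕-digits : ∀ p q x y → (bit p + 2 * x) ⊕ (bit q + 2 * y) ≡ bit (p xor q) + 2 * (x ⊕ y)
⊕-digits p q x y = begin
  a ⊕ b
    ≡⟨ ⊕-step a b ⟩
  digitXor (a % 2) (b % 2) + 2 * (a / 2 ⊕ b / 2)
    ≡⟨ cong₂ (λ u v → u + 2 * v)
             (cong₂ digitXor ([bit+2n]%2≡bit p x) ([bit+2n]%2≡bit q y))
             (cong₂ _⊕_ ([bit+2n]/2≡n p x) ([bit+2n]/2≡n q y)) ⟩
  digitXor (bit p) (bit q) + 2 * (x ⊕ y)
    ≡⟨ cong (_+ 2 * (x ⊕ y)) (digitXor-bit p q) ⟩
  bit (p xor q) + 2 * (x ⊕ y) ∎
  where
  open ≡-Reasoning
  a = bit p + 2 * x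
  b = bit q + 2 * y

⊕-%2 : ∀ x y → (x ⊕ y) % 2 ≡ (x + y) % 2
⊕-%2 x y = begin
  (x ⊕ y) % 2                               ≡⟨ cong (_% 2) (⊕-step x y) ⟩
  (lowXor x y + 2 * (x / 2 ⊕ y / 2)) % 2    ≡⟨ [m+2n]%2≡m%2 (lowXor x y) (x / 2 ⊕ y / 2) ⟩
  lowXor x y % 2                            ≡⟨ cong (_% 2) (digitXor≡[u+v]%2 (m%n<n x 2) (m%n<n y 2)) ⟩
  (x % 2 + y % 2) % 2 % 2                   ≡⟨ m%n%n≡m%n (x % 2 + y % 2) 2 ⟩
  (x % 2 + y % 2) % 2                       ≡⟨ %-distribˡ-+ x y 2 ⟨
  (x + y) % 2                               ∎
  where open ≡-Reasoning

⊕₄-%2 : ∀ a b c d → (a ⊕ b ⊕ c ⊕ d) % 2 ≡ (a + b + c + d) % 2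
⊕₄-%2 a b c d =
  trans (⊕-%2 (a ⊕ b ⊕ c) d) (%-+-congˡ (a ⊕ b ⊕ c) (a + b + c) d
    (trans (⊕-%2 (a ⊕ b) c) (%-+-congˡ (a ⊕ b) (a + b) c (⊕-%2 a b))))

⊕₄-digits : ∀ p q r t a b c d →
  (bit p + 2 * a) ⊕ (bit q + 2 * b) ⊕ (bit r + 2 * c) ⊕ (bit t + 2 * d)
    ≡ bit (((p xor q) xor r) xor t) + 2 * (a ⊕ b ⊕ c ⊕ d)
⊕₄-digits p q r t a b c d
  rewrite ⊕-digits p q a b
        | ⊕-digits (p xor q) r (a ⊕ b) c
        | ⊕-digits ((p xor q) xor r) t (a ⊕ b ⊕ c) d = refl

zeroIndicator : ℕ → ℕ
zeroIndicator x = bit ⌊ x ≟ 0 ⌋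

zeroIndicator-2* : ∀ x → zeroIndicator (2 * x) ≡ zeroIndicator x
zeroIndicator-2* zero    = refl
zeroIndicator-2* (suc x) = refl

zeroIndicator-odd : ∀ x → x % 2 ≡ 1 → zeroIndicator x ≡ 0
zeroIndicator-odd (suc x) _ = refl

zeroIndicator-⊕₄-digits : ∀ p q r t a b c d →
  zeroIndicator ((bit p + 2 * a) ⊕ (bit q + 2 * b) ⊕ (bit r + 2 * c) ⊕ (bit t + 2 * d))
    ≡ (if ((p xor q) xor r) xor t then 0 else zeroIndicator (a ⊕ b ⊕ c ⊕ d))
zeroIndicator-⊕₄-digits p q r t a b c d rewrite ⊕₄-digits p q r t a b c d
  with ((p xor q) xor r) xor t
... | false = zeroIndicator-2* (a ⊕ b ⊕ c ⊕ d)
... | true  = refl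

-- pCell k a b ≡ 1 exactly when (1 + a , 1 + b) is a P-position of C_{1+k,1+k}.
pCell : ℕ → ℕ → ℕ → ℕ
pCell k a b = zeroIndicator (a ⊕ b ⊕ (k ∸ a) ⊕ (k ∸ b))

pCount : ℕ → ℕ
pCount k = ∑[ a < suc k ] ∑[ b < suc k ] pCell k a b

pCell-digits : ∀ k p q r t a b {c d} →
  k ∸ (bit p + 2 * a) ≡ bit r + 2 * c → k ∸ (bit q + 2 * b) ≡ bit t + 2 * d →
  pCell k (bit p + 2 * a) (bit q + 2 * b)
    ≡ (if ((p xor q) xor r) xor t then 0 else zeroIndicator (a ⊕ b ⊕ c ⊕ d))
pCell-digits k p q r t a b {c} {d} k∸A k∸B = trans
  (cong₂ (λ C D → zeroIndicator ((bit p + 2 * a) ⊕ (bit q + 2 * b) ⊕ C ⊕ D)) k∸A k∸B)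
  (zeroIndicator-⊕₄-digits p q r t a b c d)

odd∸digit : ∀ p {s a} → a ≤ s → (1 + 2 * s) ∸ (bit p + 2 * a) ≡ bit (not p) + 2 * (s ∸ a)
odd∸digit false {s} {a} a≤s =
  trans (+-∸-assoc 1 (*-monoʳ-≤ 2 a≤s)) (cong suc (sym (*-distribˡ-∸ 2 s a)))
odd∸digit true  {s} {a} _   = sym (*-distribˡ-∸ 2 s a)

even∸odd : ∀ {s a} → a ≤ s → 2 * suc s ∸ (1 + 2 * a) ≡ 1 + 2 * (s ∸ a)
even∸odd {s} {a} a≤s = trans (cong (_∸ (1 + 2 * a)) (*-suc 2 s)) (odd∸digit false a≤s)

xor-complements : ∀ p q → ((p xor q) xor not p) xor not q ≡ false
xor-complements false false = refl
xor-complements false true  = refl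
xor-complements true  false = refl
xor-complements true  true  = refl

pCell-odd : ∀ p q {s a b} → a ≤ s → b ≤ s →
            pCell (1 + 2 * s) (bit p + 2 * a) (bit q + 2 * b) ≡ pCell s a b
pCell-odd p q {s} {a} {b} a≤s b≤s = trans
  (pCell-digits (1 + 2 * s) p q (not p) (not q) a b (odd∸digit p a≤s) (odd∸digit q b≤s))
  (cong (λ e → if e then 0 else pCell s a b) (xor-complements p q))

pCell-even-ee : ∀ s a b → pCell (2 * suc s) (2 * a) (2 * b) ≡ pCell (suc s) a b
pCell-even-ee s a b = pCell-digits (2 * suc s) false false false false a b
  (sym (*-distribˡ-∸ 2 (suc s) a)) (sym (*-distribˡ-∸ 2 (suc s) b))

pCell-even-oo : ∀ {s a b} → a ≤ s → b ≤ s →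
                pCell (2 * suc s) (1 + 2 * a) (1 + 2 * b) ≡ pCell s a b
pCell-even-oo {s} {a} {b} a≤s b≤s =
  pCell-digits (2 * suc s) true true true true a b (even∸odd a≤s) (even∸odd b≤s)

complements-sum : ∀ {a b m n} → a ≤ m → b ≤ n → a + b + (m ∸ a) + (n ∸ b) ≡ m + n
complements-sum {a} {b} {m} {n} a≤m b≤n = begin
  a + b + (m ∸ a) + (n ∸ b)       ≡⟨ +-assoc (a + b) (m ∸ a) (n ∸ b) ⟩
  a + b + (m ∸ a + (n ∸ b))       ≡⟨ interchange a b (m ∸ a) (n ∸ b) ⟩
  a + (m ∸ a) + (b + (n ∸ b))     ≡⟨ cong₂ _+_ (m+[n∸m]≡n a≤m) (m+[n∸m]≡n b≤n) ⟩
  m + n                           ∎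
  where open ≡-Reasoning

[1+n+n]%2≡1 : ∀ n → (suc n + n) % 2 ≡ 1
[1+n+n]%2≡1 n = trans (cong (λ k → suc (n + k) % 2) (sym (+-identityʳ n))) ([bit+2n]%2≡bit true n)

pCell-even-eo : ∀ {s a b} → a ≤ suc s → b ≤ s → pCell (2 * suc s) (2 * a) (1 + 2 * b) ≡ 0
pCell-even-eo {s} {a} {b} a≤1+s b≤s = trans
  (pCell-digits (2 * suc s) false true false true a b (sym (*-distribˡ-∸ 2 (suc s) a)) (even∸odd b≤s))
  (zeroIndicator-odd (a ⊕ b ⊕ (suc s ∸ a) ⊕ (s ∸ b)) (begin
    (a ⊕ b ⊕ (suc s ∸ a) ⊕ (s ∸ b)) % 2      ≡⟨ ⊕₄-%2 a b (suc s ∸ a) (s ∸ b) ⟩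
    (a + b + (suc s ∸ a) + (s ∸ b)) % 2      ≡⟨ cong (_% 2) (complements-sum a≤1+s b≤s) ⟩
    (suc s + s) % 2                          ≡⟨ [1+n+n]%2≡1 s ⟩
    1                                        ∎))
  where open ≡-Reasoning

pCell-even-oe : ∀ {s a b} → a ≤ s → b ≤ suc s → pCell (2 * suc s) (1 + 2 * a) (2 * b) ≡ 0
pCell-even-oe {s} {a} {b} a≤s b≤1+s = trans
  (pCell-digits (2 * suc s) true false true false a b (even∸odd a≤s) (sym (*-distribˡ-∸ 2 (suc s) b)))
  (zeroIndicator-odd (a ⊕ b ⊕ (s ∸ a) ⊕ (suc s ∸ b)) (begin
    (a ⊕ b ⊕ (s ∸ a) ⊕ (suc s ∸ b)) % 2      ≡⟨ ⊕₄-%2 a b (s ∸ a) (suc s ∸ b) ⟩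
    (a + b + (s ∸ a) + (suc s ∸ b)) % 2      ≡⟨ cong (_% 2) (complements-sum a≤s b≤1+s) ⟩
    (s + suc s) % 2                          ≡⟨ cong (_% 2) (+-comm s (suc s)) ⟩
    (suc s + s) % 2                          ≡⟨ [1+n+n]%2≡1 s ⟩
    1                                        ∎))
  where open ≡-Reasoning

pCount-odd : ∀ s → pCount (1 + 2 * s) ≡ 4 * pCount s
pCount-odd s = begin
  pCount k
    ≡⟨ cong (λ m → ∑[ a < m ] ∑[ b < m ] pCell k a b) (*-suc 2 s) ⟨
  ∑[ a < 2 * suc s ] ∑[ b < 2 * suc s ] pCell k a b
    ≡⟨ ∑-2*-same (suc s) (λ a → ∑[ b < 2 * suc s ] pCell k a b) (λ a → 2 * pRow a)
                 (row false) (row true) ⟩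
  2 * ∑[ a < suc s ] (2 * pRow a)
    ≡⟨ cong (2 *_) (∑-* (suc s) 2 pRow) ⟩
  2 * (2 * pCount s)
    ≡⟨ *-assoc 2 2 (pCount s) ⟨
  4 * pCount s ∎
  where
  open ≡-Reasoning
  k = 1 + 2 * s
  pRow : ℕ → ℕ
  pRow a = ∑[ b < suc s ] pCell s a b
  row : ∀ p a → a < suc s →
        ∑[ b < 2 * suc s ] pCell k (bit p + 2 * a) b ≡ 2 * ∑[ b < suc s ] pCell s a b
  row p a a<1+s = ∑-2*-same (suc s) (pCell k (bit p + 2 * a)) (pCell s a)
    (λ b b<1+s → pCell-odd p false (s≤s⁻¹ a<1+s) (s≤s⁻¹ b<1+s))
    (λ b b<1+s → pCell-odd p true  (s≤s⁻¹ a<1+s) (s≤s⁻¹ b<1+s))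

pCount-even : ∀ s → pCount (2 * suc s) ≡ pCount (suc s) + pCount s
pCount-even s = begin
  pCount k
    ≡⟨ ∑-1+2* (suc s) row ⟩
  ∑[ a < suc (suc s) ] row (2 * a) + ∑[ a < suc s ] row (1 + 2 * a)
    ≡⟨ cong₂ _+_ (∑-cong (suc (suc s)) evenRow) (∑-cong (suc s) oddRow) ⟩
  pCount (suc s) + pCount s ∎
  where
  open ≡-Reasoning
  k = 2 * suc s
  row : ℕ → ℕ
  row a = ∑[ b < suc k ] pCell k a b
  evenRow : ∀ a → a < suc (suc s) → row (2 * a) ≡ ∑[ b < suc (suc s) ] pCell (suc s) a b
  evenRow a a<2+s = begin
    row (2 * a)
      ≡⟨ ∑-1+2* (suc s) (pCell k (2 * a)) ⟩
    ∑[ b < suc (suc s) ] pCell k (2 * a) (2 * b) + ∑[ b < suc s ] pCell k (2 * a) (1 + 2 * b)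
      ≡⟨ cong₂ _+_ (∑-cong (suc (suc s)) (λ b _ → pCell-even-ee s a b))
                   (∑-cong (suc s) (λ b b<1+s → pCell-even-eo (s≤s⁻¹ a<2+s) (s≤s⁻¹ b<1+s))) ⟩
    ∑[ b < suc (suc s) ] pCell (suc s) a b + ∑[ b < suc s ] 0
      ≡⟨ cong (∑[ b < suc (suc s) ] pCell (suc s) a b +_) (∑-zero (suc s)) ⟩
    ∑[ b < suc (suc s) ] pCell (suc s) a b + 0
      ≡⟨ +-identityʳ _ ⟩
    ∑[ b < suc (suc s) ] pCell (suc s) a b ∎
  oddRow : ∀ a → a < suc s → row (1 + 2 * a) ≡ ∑[ b < suc s ] pCell s a b
  oddRow a a<1+s = begin
    row (1 + 2 * a)
      ≡⟨ ∑-1+2* (suc s) (pCell k (1 + 2 * a)) ⟩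
    ∑[ b < suc (suc s) ] pCell k (1 + 2 * a) (2 * b) + ∑[ b < suc s ] pCell k (1 + 2 * a) (1 + 2 * b)
      ≡⟨ cong₂ _+_ (∑-cong (suc (suc s)) (λ b b<2+s → pCell-even-oe (s≤s⁻¹ a<1+s) (s≤s⁻¹ b<2+s)))
                   (∑-cong (suc s) (λ b b<1+s → pCell-even-oo (s≤s⁻¹ a<1+s) (s≤s⁻¹ b<1+s))) ⟩
    ∑[ b < suc (suc s) ] 0 + ∑[ b < suc s ] pCell s a b
      ≡⟨ cong (_+ ∑[ b < suc s ] pCell s a b) (∑-zero (suc (suc s))) ⟩
    ∑[ b < suc s ] pCell s a b ∎

∑-pCount-double : ∀ m → ∑< (2 * suc m) pCount + pCount m ≡ 6 * ∑< (suc m) pCount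
∑-pCount-double m = begin
  ∑< (2 * suc m) pCount + pCount m
    ≡⟨ cong (_+ pCount m) (∑-2* (suc m) pCount) ⟩
  ∑[ k < suc m ] pCount (2 * k) + ∑[ k < suc m ] pCount (1 + 2 * k) + pCount m
    ≡⟨ cong₂ (λ E O → E + O + pCount m) evens odds ⟩
  S + ∑< m pCount + 4 * S + pCount m
    ≡⟨ xy∙z≈xz∙y (S + ∑< m pCount) (4 * S) (pCount m) ⟩
  S + ∑< m pCount + pCount m + 4 * S
    ≡⟨ cong (_+ 4 * S) (+-assoc S (∑< m pCount) (pCount m)) ⟩
  S + (∑< m pCount + pCount m) + 4 * S
    ≡⟨ cong (λ T → S + T + 4 * S) (∑-snoc m pCount) ⟨
  S + S + 4 * S
    ≡⟨ +-assoc S S (4 * S) ⟩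
  6 * S ∎
  where
  open ≡-Reasoning
  S = ∑< (suc m) pCount
  evens : ∑[ k < suc m ] pCount (2 * k) ≡ S + ∑< m pCount
  evens = begin
    pCount 0 + ∑[ k < m ] pCount (2 * suc k)
      ≡⟨ cong (pCount 0 +_) (∑-cong m (λ k _ → pCount-even k)) ⟩
    pCount 0 + ∑[ k < m ] (pCount (suc k) + pCount k)
      ≡⟨ cong (pCount 0 +_) (∑-+ m (pCount ∘ suc) pCount) ⟩
    pCount 0 + (∑[ k < m ] pCount (suc k) + ∑< m pCount)
      ≡⟨ +-assoc (pCount 0) (∑[ k < m ] pCount (suc k)) (∑< m pCount) ⟨
    S + ∑< m pCount ∎
  odds : ∑[ k < suc m ] pCount (1 + 2 * k) ≡ 4 * S
  odds = trans (∑-cong (suc m) (λ k _ → pCount-odd k)) (∑-* (suc m) 4 pCount)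

mersenne : ℕ → ℕ
mersenne zero    = 0
mersenne (suc n) = 1 + 2 * mersenne n

suc-mersenne : ∀ n → suc (mersenne n) ≡ 2 ^ n
suc-mersenne zero    = refl
suc-mersenne (suc n) = trans (sym (*-suc 2 (mersenne n))) (cong (2 *_) (suc-mersenne n))

pCount-mersenne : ∀ n → pCount (mersenne n) ≡ 4 ^ n
pCount-mersenne zero    = refl
pCount-mersenne (suc n) = trans (pCount-odd (mersenne n)) (cong (4 *_) (pCount-mersenne n))

6*[x+y]≡4*x+6*y+2*x : ∀ x y → 6 * (x + y) ≡ 4 * x + 6 * y + 2 * x
6*[x+y]≡4*x+6*y+2*x = solve-∀

∑-pCount-2^ : ∀ n → 2 * ∑< (2 ^ n) pCount ≡ 4 ^ n + 6 ^ n
∑-pCount-2^ zero    = refl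
∑-pCount-2^ (suc n) = +-cancelʳ-≡ (2 * 4 ^ n) (2 * S′) (4 ^ suc n + 6 ^ suc n) (begin
  2 * S′ + 2 * 4 ^ n         ≡⟨ *-distribˡ-+ 2 S′ (4 ^ n) ⟨
  2 * (S′ + 4 ^ n)           ≡⟨ cong (2 *_) doubling ⟩
  2 * (6 * S)                ≡⟨ trans (sym (*-assoc 2 6 S)) (*-assoc 6 2 S) ⟩
  6 * (2 * S)                ≡⟨ cong (6 *_) (∑-pCount-2^ n) ⟩
  6 * (4 ^ n + 6 ^ n)        ≡⟨ 6*[x+y]≡4*x+6*y+2*x (4 ^ n) (6 ^ n) ⟩
  4 ^ suc n + 6 ^ suc n + 2 * 4 ^ n ∎)
  where
  open ≡-Reasoning
  S = ∑< (2 ^ n) pCount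
  S′ = ∑< (2 ^ suc n) pCount
  doubling : S′ + 4 ^ n ≡ 6 * S
  doubling rewrite sym (suc-mersenne n) | sym (pCount-mersenne n) = ∑-pCount-double (mersenne n)

g-suc : ∀ k → g (suc k) ≡ pCount k
g-suc k = begin
  g (suc k)
    ≡⟨ length-filter≡sum-bit (isP (suc k)) (cells (suc k)) ⟩
  sum (map F (cells (suc k)))
    ≡⟨ sum-map-concatMap F (λ i → map (i ,_) (range1 (suc k))) (range1 (suc k)) ⟩
  sum (map (λ i → sum (map F (map (i ,_) (range1 (suc k))))) (range1 (suc k)))
    ≡⟨ sum-map-range1 (λ i → sum (map F (map (i ,_) (range1 (suc k))))) (suc k) ⟩
  ∑[ a < suc k ] sum (map F (map (suc a ,_) (range1 (suc k))))
    ≡⟨ ∑-cong (suc k) (λ a _ → row a) ⟩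
  pCount k ∎
  where
  open ≡-Reasoning
  F : ℕ × ℕ → ℕ
  F = bit ∘ isP (suc k)
  row : ∀ a → sum (map F (map (suc a ,_) (range1 (suc k)))) ≡ ∑[ b < suc k ] pCell k a b
  row a = trans (cong sum (sym (map-∘ (range1 (suc k))))) (sum-map-range1 (F ∘ (suc a ,_)) (suc k))

sumG≡∑pCount : ∀ N → sumG N ≡ ∑< N pCount
sumG≡∑pCount N = trans (sum-map-range1 g N) (∑-cong N (λ k _ → g-suc k))

theorem5 : (n : ℕ) → 1 Data.Nat.≤ n →
    2 * sumG (2 ^ n) ≡ 4 ^ n + 6 ^ n
theorem5 n _ = trans (cong (2 *_) (sumG≡∑pCount (2 ^ n))) (∑-pCount-2^ n)
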